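{- Fix an integer $h\ge1$ and consider the tree $T$ and active set obtained (under the reference semantics) after any valid sequence of tree-buffer operations. Then every recent node has height less than $2h$, i.e., $R\subseteq H_{<2h}$.
   Context: A valid sequence of tree-buffer operations is $\mathrm{initialize}(x_0)$ followed by modifying operations $\mathrm{add\_child}(x,y)$ or $\mathrm{deactivate}(x)$, with the following semantics on a rooted tree $T$ and a set $\mathrm{Active}\subseteq T$: initialize creates the tree with single node $x_0$ (the root), Active $=\{x_0\}$; $\mathrm{add\_child}(x,y)$ requires $x\in$ Active and $y$ fresh, and adds $y$ to $T$ as a child of $x$ and to Active; $\mathrm{deactivate}(x)$ removes $x$ from Active (nodes are never removed from $T$). The subtree of $x$ is $x$ together with its descendants. The height of $x$ is the minimum distance from $x$ to an active node in its subtree ($\infty$ if none); $H_{<i}$ is the set of nodes of height $<i$. The depth of a node is its distance to the root, and its level is $\mathrm{level}(x)=\lfloor \mathrm{depth}(x)/h\rfloor$. A node $x$ is recent if there exists an active node $y$ in the subtree of $x$ with $\mathrm{level}(x)\ge\mathrm{level}(y)-1$; $R$ denotes the set of recent nodes. -}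

module Defs where

open import Data.Nat using (ℕ; zero; suc; _≤_; _<_; _≡ᵇ_; NonZero)
open import Data.Nat.DivMod using (_/_)
open import Data.Bool using (Bool; true; false; if_then_else_)
open import Data.List using (List; []; _∷_)
open import Data.List.Membership.Propositional using (_∈_; _∉_)
open import Data.Product using (_×_; _,_; ∃-syntax)
open import Relation.Binary.PropositionalEquality using (_≡_)

-- Nodes are labelled by natural numbers.
-- A tree-buffer state: the root, the list of nodes of T, the list of
-- (child , parent) edges, and the characteristic function of Active.
record State : Set where
  constructor mkState
  field
    root   : ℕ
    nodes  : List ℕ
    edges  : List (ℕ × ℕ)
    active : ℕ → Bool
open State public

initState : ℕ → State
initState x₀ = mkState x₀ (x₀ ∷ []) [] (λ z → z ≡ᵇ x₀)

addChildState : State → ℕ → ℕ → State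
addChildState s x y =
  mkState (root s) (y ∷ nodes s) ((y , x) ∷ edges s)
          (λ z → if z ≡ᵇ y then true else active s z)

deactivateState : State → ℕ → State
deactivateState s x =
  mkState (root s) (nodes s) (edges s)
          (λ z → if z ≡ᵇ x then false else active s z)

Active : State → ℕ → Set
Active s x = active s x ≡ true

data Reachable : State → Set where
  initialize : (x₀ : ℕ) → Reachable (initState x₀)
  add-child  : ∀ {s} (x y : ℕ) → Reachable s → Active s x → y ∉ nodes s →
               Reachable (addChildState s x y)
  deactivate : ∀ {s} (x : ℕ) → Reachable s → Reachable (deactivateState s x)

data DescPath (s : State) : ℕ → ℕ → ℕ → Set where
  here : ∀ {x} → DescPath s x x 0
  step : ∀ {x z y d} → DescPath s x z d → (y , z) ∈ edges s →
         DescPath s x y (suc d)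

Depth : State → ℕ → ℕ → Set
Depth s x d = DescPath s (root s) x d

level : (h : ℕ) .{{_ : NonZero h}} → ℕ → ℕ
level h d = d / h

-- x is recent: some active y in the subtree of x with level(x) ≥ level(y) − 1
-- (i.e. level(y) ≤ level(x) + 1).
Recent : (h : ℕ) .{{_ : NonZero h}} → State → ℕ → Set
Recent h s x = ∃[ y ] ∃[ d ] ∃[ dx ] ∃[ dy ]
  (Active s y × DescPath s x y d × Depth s x dx × Depth s y dy ×
   level h dy ≤ suc (level h dx))

-- x ∈ H_{<i}: height(x) < i, i.e. some active node in the subtree of x
-- is at distance < i from x (height is the minimum such distance).
HeightLt : ℕ → State → ℕ → Set
HeightLt i s x = ∃[ y ] ∃[ d ] (Active s y × DescPath s x y d × d < i)

-- Depths in the tree are well defined: every state reached by the operations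
-- is a genuine tree (the root has no parent and every node at most one), so
-- any two paths from the root to a node have the same length.  If y is an
-- active node in the subtree of x at distance d, then depth y = depth x + d,
-- and level y ≤ level x + 1 forces d < 2h, because two depths whose levels
-- differ by at most k differ by less than (k + 1) h.
module Submission where

open import Defs
open import Data.Nat using (ℕ; suc; _+_; _*_; _≤_; _<_; NonZero)
open import Data.Nat.Properties
open import Data.Nat.DivMod using (_/_; _%_; m/n*n≤m; m≡m%n+[m/n]*n; m%n<n)
open import Data.Product using (_,_)
open import Data.List using (_∷_)
open import Data.List.Membership.Propositional using (_∈_; _∉_)
open import Data.List.Relation.Unary.Any using (here; there)
open import Data.Empty using (⊥-elim)
open import Relation.Binary.PropositionalEquality using (_≡_; refl; cong; subst)

record IsTree (s : State) : Set where
  field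
    root∈nodes      : root s ∈ nodes s
    child∈nodes     : ∀ {a b} → (a , b) ∈ edges s → a ∈ nodes s
    root-parentless : ∀ {b} → (root s , b) ∉ edges s
    parent-unique   : ∀ {a b c} → (a , b) ∈ edges s → (a , c) ∈ edges s → b ≡ c
open IsTree

isTree-initState : ∀ x₀ → IsTree (initState x₀)
isTree-initState x₀ = record
  { root∈nodes      = here refl
  ; child∈nodes     = λ ()
  ; root-parentless = λ ()
  ; parent-unique   = λ ()
  }

isTree-addChildState : ∀ {s x y} → IsTree s → y ∉ nodes s → IsTree (addChildState s x y)
isTree-addChildState {s} {x} {y} t y∉s = record
  { root∈nodes      = there (root∈nodes t)
  ; child∈nodes     = child∈
  ; root-parentless = parentless
  ; parent-unique   = unique
  }
  where
  child∈ : ∀ {a b} → (a , b) ∈ (y , x) ∷ edges s → a ∈ y ∷ nodes s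
  child∈ (here refl) = here refl
  child∈ (there e)   = there (child∈nodes t e)

  parentless : ∀ {b} → (root s , b) ∉ (y , x) ∷ edges s
  parentless (here refl) = y∉s (root∈nodes t)
  parentless (there e)   = root-parentless t e

  unique : ∀ {a b c} → (a , b) ∈ (y , x) ∷ edges s → (a , c) ∈ (y , x) ∷ edges s → b ≡ c
  unique (here refl) (here refl) = refl
  unique (here refl) (there e)   = ⊥-elim (y∉s (child∈nodes t e))
  unique (there e)   (here refl) = ⊥-elim (y∉s (child∈nodes t e))
  unique (there e)   (there e′)  = parent-unique t e e′

isTree-deactivateState : ∀ {s x} → IsTree s → IsTree (deactivateState s x)
isTree-deactivateState t = record
  { root∈nodes      = root∈nodes t
  ; child∈nodes     = child∈nodes t
  ; root-parentless = root-parentless t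
  ; parent-unique   = parent-unique t
  }

reachable⇒isTree : ∀ {s} → Reachable s → IsTree s
reachable⇒isTree (initialize x₀)         = isTree-initState x₀
reachable⇒isTree (add-child _ _ r _ y∉s) = isTree-addChildState (reachable⇒isTree r) y∉s
reachable⇒isTree (deactivate _ r)        = isTree-deactivateState (reachable⇒isTree r)

descPath-trans : ∀ {s x y z a b} → DescPath s x y a → DescPath s y z b → DescPath s x z (b + a)
descPath-trans p here       = p
descPath-trans p (step q e) = step (descPath-trans p q) e

depth-unique : ∀ {s} → IsTree s → ∀ {y d₁ d₂} → Depth s y d₁ → Depth s y d₂ → d₁ ≡ d₂
depth-unique t here       here        = refl
depth-unique t here       (step _ e)  = ⊥-elim (root-parentless t e)
depth-unique t (step _ e) here        = ⊥-elim (root-parentless t e)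
depth-unique t (step p e) (step q e′) with parent-unique t e e′
... | refl = cong suc (depth-unique t p q)

quotient-close⇒distance-small : ∀ h .{{_ : NonZero h}} k d m →
  (d + m) / h ≤ k + m / h → d < suc k * h
quotient-close⇒distance-small h k d m close =
  +-cancelʳ-< (m / h * h) d (suc k * h) (begin-strict
    d + m / h * h                   ≤⟨ +-monoʳ-≤ d (m/n*n≤m m h) ⟩
    d + m                           ≡⟨ m≡m%n+[m/n]*n (d + m) h ⟩
    (d + m) % h + (d + m) / h * h   <⟨ +-monoˡ-< _ (m%n<n (d + m) h) ⟩
    h + (d + m) / h * h             ≤⟨ +-monoʳ-≤ h (*-monoˡ-≤ h close) ⟩
    h + (k + m / h) * h             ≡⟨ cong (h +_) (*-distribʳ-+ h k (m / h)) ⟩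
    h + (k * h + m / h * h)         ≡⟨ +-assoc h (k * h) (m / h * h) ⟨
    suc k * h + m / h * h           ∎)
  where open ≤-Reasoning

lemma4 : (h : ℕ) .{{_ : NonZero h}} → (s : State) → Reachable s →
         (x : ℕ) → Recent h s x → HeightLt (2 * h) s x
lemma4 h s r x (y , d , dx , dy , y-active , x⇝y , depth-x , depth-y , levels-close) =
  y , d , y-active , x⇝y , quotient-close⇒distance-small h 1 d dx levels-close′
  where
  dy≡d+dx : dy ≡ d + dx
  dy≡d+dx = depth-unique (reachable⇒isTree r) depth-y (descPath-trans depth-x x⇝y)

  levels-close′ : (d + dx) / h ≤ 1 + dx / h
  levels-close′ = subst (λ e → e / h ≤ suc (dx / h)) dy≡d+dx levels-close
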